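{- There is an absolute constant $c>0$ such that the following holds. Let $n\geq 3$ be odd, $k=\frac{n-3}{2}$, $G=(V,E)=K_n$, let $C=(v_1,\dots,v_{2k+1})$ be a cycle of length $n-2$ in $G$ with $s,t$ the two vertices not on $C$, and let $F$ be the facet of $P_{(\widehat G,\widehat R)}$ defined by the canonical transformation \[\sum_{\{u,v\}\in E}a_{\{u,v\}}\bigl(y_{\{u^+,v^-\}}+y_{\{u^-,v^+\}}\bigr)\geq 2k+1\] of the $C$-induced constraint, where $a_{\{s,t\}}=1$, $a_e=k$ for edges with exactly one endpoint in $\{s,t\}$, and $a_{\{v_i,v_j\}}=\ell(\{v_i,v_j\})$. Then there exist $\widehat a\in\mathbb{Z}^{\widehat E}$ and $\widehat b\in\mathbb{Z}$ such that $F=\{y\in P_{(\widehat G,\widehat R)}\colon \widehat a^\top y=\widehat b\}$ and $|\{\widehat a_{\widehat e}\colon \widehat e\in\widehat E\}|\leq c\,n^{2/3}$, i.e., $O(n^{2/3})$ distinct coefficients suffice.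
   Context: For $i\neq j$, $\ell(\{v_i,v_j\}):=|j-i|$ if $|j-i|$ is odd and $2k+1-|j-i|$ otherwise. The bipartite graph $\widehat G=(\widehat V,\widehat E)$ has vertex set $V^+\cup V^-$ with $V^{\pm}=\{v^{\pm}\colon v\in V\}$ and edges $\{v^+,v^-\}$ for $v\in V$ and $\{u^+,v^-\}$, $\{u^-,v^+\}$ for $\{u,v\}\in E$; red edges $\widehat R:=\widehat E\setminus\{\{v^+,v^-\}\colon v\in V\}$. $P_{(\widehat G,\widehat R)}:=\operatorname{conv}\{\chi^M\colon M\text{ perfect matching of }\widehat G,\ |M\cap\widehat R|\text{ odd}\}$. (The canonical transformation of the $C$-induced constraint is facet-defining for this polytope.)
   Formalization: Points of the polytope $P_{(\widehat G,\widehat R)}$ and of the facet F have rational coordinates. -}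

module Defs where

open import Data.Bool using (Bool; true; false; if_then_else_; _∧_; not)
open import Data.Nat as ℕ using (ℕ; zero; suc; _∸_; _%_; _≡ᵇ_; _<ᵇ_)
open import Data.Integer as ℤ using (ℤ; +_)
open import Data.Integer.Properties using () renaming (_≟_ to _≟ℤ_)
open import Data.Rational as ℚ using (ℚ; 0ℚ; 1ℚ; _/_)
open import Data.Fin using (Fin; toℕ; _≟_)
open import Data.Fin.Permutation using (Permutation′; _⟨$⟩ˡ_)
open import Data.List using (List; []; _∷_; map; foldr; length; deduplicate; allFin; concatMap; filterᵇ)
open import Data.List.Relation.Unary.All using (All)
open import Data.Product using (Σ; ∃; _×_; _,_; proj₁; proj₂)
open import Relation.Binary.PropositionalEquality using (_≡_)
open import Relation.Nullary.Decidable using (⌊_⌋)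

-- Setting: n = 3 + 2k (every odd n ≥ 3), V = Fin n, G = K_n.
-- Edges of Ĝ are identified with ordered pairs (u , w) ∈ V × V:
-- (u , w) stands for the edge {u⁺ , w⁻}.  The diagonal (v , v) is
-- the edge {v⁺ , v⁻}; off-diagonal pairs are the red edges R̂.

EVec : ℕ → Set → Set
EVec n A = Fin n → Fin n → A

allEdges : (n : ℕ) → List (Fin n × Fin n)
allEdges n = concatMap (λ u → map (λ w → (u , w)) (allFin n)) (allFin n)

isRed : {n : ℕ} → Fin n × Fin n → Bool
isRed (u , w) = not ⌊ u ≟ w ⌋

sumℚ : List ℚ → ℚ
sumℚ = foldr ℚ._+_ 0ℚ

sumE : (n : ℕ) → ((Fin n × Fin n) → ℚ) → ℚ
sumE n f = sumℚ (map f (allEdges n))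

IsPerfectMatching : {n : ℕ} → EVec n Bool → Set
IsPerfectMatching {n} M =
  ((u : Fin n) → Σ (Fin n) λ w → (M u w ≡ true) × ((w′ : Fin n) → M u w′ ≡ true → w′ ≡ w))
  × ((w : Fin n) → Σ (Fin n) λ u → (M u w ≡ true) × ((u′ : Fin n) → M u′ w ≡ true → u′ ≡ u))

isOddℕ : ℕ → Bool
isOddℕ m = m % 2 ≡ᵇ 1

OddRed : {n : ℕ} → EVec n Bool → Set
OddRed {n} M = isOddℕ (length (filterᵇ (λ e → M (proj₁ e) (proj₂ e) ∧ isRed e) (allEdges n))) ≡ true

χ : {n : ℕ} → EVec n Bool → EVec n ℚ
χ M u w = if M u w then 1ℚ else 0ℚ

-- y ∈ P_(Ĝ,R̂) = conv{ χ^M : M perfect matching of Ĝ, |M ∩ R̂| odd },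
-- with y a rational vector (finite convex combinations).
InP : {n : ℕ} → EVec n ℚ → Set
InP {n} y = Σ (List (ℚ × EVec n Bool)) λ L →
    All (λ p → (0ℚ ℚ.≤ proj₁ p) × IsPerfectMatching (proj₂ p) × OddRed (proj₂ p)) L
  × (sumℚ (map proj₁ L) ≡ 1ℚ)
  × ((u w : Fin n) → y u w ≡ sumℚ (map (λ p → proj₁ p ℚ.* χ (proj₂ p) u w) L))

dist : ℕ → ℕ → ℕ
dist a b = (a ∸ b) ℕ.+ (b ∸ a)

-- Coefficients a_{x,y} of the C-induced constraint, in canonical labels:
-- label i < 2k+1 is the cycle vertex v_{i+1}; labels 2k+1, 2k+2 are s, t.
-- (Diagonal value 0: there is no edge {v,v} in E.)
aCanon : (k : ℕ) → Fin (3 ℕ.+ 2 ℕ.* k) → Fin (3 ℕ.+ 2 ℕ.* k) → ℕ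
aCanon k i j =
  if toℕ i ≡ᵇ toℕ j then 0
  else if not (toℕ i <ᵇ m) ∧ not (toℕ j <ᵇ m) then 1
  else if not (toℕ i <ᵇ m) ∧ (toℕ j <ᵇ m) then k
  else if (toℕ i <ᵇ m) ∧ not (toℕ j <ᵇ m) then k
  else ℓ (dist (toℕ i) (toℕ j))
  where
  m = suc (2 ℕ.* k)
  ℓ : ℕ → ℕ
  ℓ d = if isOddℕ d then d else m ∸ d

-- Coefficients for the cycle C given by a labelling π of V = Fin n:
-- v_{i+1} = π(i) for i < 2k+1, s = π(2k+1), t = π(2k+2).
aC : (k : ℕ) → Permutation′ (3 ℕ.+ 2 ℕ.* k) → Fin (3 ℕ.+ 2 ℕ.* k) → Fin (3 ℕ.+ 2 ℕ.* k) → ℕ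
aC k π u v = aCanon k (π ⟨$⟩ˡ u) (π ⟨$⟩ˡ v)

-- Left-hand side of the canonical transformation:
-- Σ_{{u,v}∈E} a_{uv} (y_{u⁺v⁻} + y_{u⁻v⁺}) = Σ_{(u,w), u ≠ w} a_{uw} y_{(u,w)}
canonLHS : (k : ℕ) → Permutation′ (3 ℕ.+ 2 ℕ.* k) → EVec (3 ℕ.+ 2 ℕ.* k) ℚ → ℚ
canonLHS k π y = sumE _ (λ e → if isRed e
  then ((+ aC k π (proj₁ e) (proj₂ e)) / 1) ℚ.* y (proj₁ e) (proj₂ e) else 0ℚ)

dotℤ : {n : ℕ} → EVec n ℤ → EVec n ℚ → ℚ
dotℤ {n} a y = sumE n (λ e → (a (proj₁ e) (proj₂ e) / 1) ℚ.* y (proj₁ e) (proj₂ e))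

numDistinct : {n : ℕ} → EVec n ℤ → ℕ
numDistinct {n} a = length (deduplicate _≟ℤ_ (map (λ e → a (proj₁ e) (proj₂ e)) (allEdges n)))

{-# OPTIONS --safe #-}
-- Adding a potential difference ν(w) − ν(u) to the coefficient of every edge {u⁺, w⁻} adds
-- Σ_u Σ_w (ν(w) − ν(u)) y_{uw} to the left-hand side, and this vanishes on P because every
-- convex combination of perfect matchings has all row and column sums equal to 1.  So every
-- such shift defines the same facet with the same right-hand side 2k+1.
--
-- Take s with 2k+1 ≤ s³ ≤ 8(2k+1), write a cycle label as x = A s² + a s + b in base s and use
-- the potential φ(x) = A s² − b on the cycle (and 0 at s and t).  On a cycle edge ℓ equals
-- c ± (y − x) with c ∈ {0, 2k+1}, so the shifted coefficient becomes c + 2s²ΔA + sΔa or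
-- c − sΔa − 2Δb; on an edge at s or t it becomes k ± (s²A − b).  All digit differences lie in
-- (−s, s), hence there are at most 8 (2s)² = O(n^{2/3}) distinct coefficients.
module Submission where

open import Defs
open import Algebra.Bundles using (CommutativeRing; CommutativeMonoid)
import Algebra.Properties.CommutativeSemigroup as CommutativeSemigroupProperties
open import Data.Bool using (Bool; true; false; if_then_else_)
open import Data.Bool.Properties using (¬-not)
open import Data.Fin using (Fin; toℕ; punchIn)
open import Data.Fin.Permutation using (Permutation′; _⟨$⟩ˡ_)
open import Data.Fin.Properties using (punchInᵢ≢i)
import Data.Integer.Properties as ℤ
open import Data.List
  using (List; []; _∷_; _++_; map; length; deduplicate; allFin; tabulate; concatMap; upTo;
         cartesianProduct; cartesianProductWith)
open import Data.List.Properties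
  using (length-removeAt′; length-++; length-map; length-upTo; map-++; map-∘; map-tabulate; map-cong;
         map-cong-local)
open import Data.List.Membership.Propositional using (_∈_; _─_)
open import Data.List.Membership.Propositional.Properties
  using (∈-++⁺ˡ; ∈-++⁺ʳ; ∈-map⁺; ∈-upTo⁺; ∈-cartesianProductWith⁺; ∈-cartesianProduct⁺)
open import Data.List.Relation.Unary.All as All using (All; []; _∷_)
open import Data.List.Relation.Unary.All.Properties using (deduplicate⁺; map⁺)
open import Data.List.Relation.Unary.Any using (here; there)
open import Data.List.Relation.Unary.AllPairs using ([]; _∷_)
open import Data.List.Relation.Unary.Unique.Propositional using (Unique)
open import Data.List.Relation.Unary.Unique.DecPropositional.Properties using (deduplicate-!)
open import Data.Nat using (ℕ)
import Data.Nat as ℕ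
import Data.Nat.Properties as ℕ
open import Data.Nat.DivMod using (m≡m%n+[m/n]*n; m%n<n; m<n*o⇒m/o<n)
open import Data.Product using (Σ; _×_; _,_; proj₁; proj₂)
open import Data.Sum using (_⊎_; inj₁; inj₂)
open import Function using (_∘_)
open import Function.Bundles using (_⇔_; mk⇔)
open import Relation.Binary.Definitions using (DecidableEquality)
open import Relation.Binary.PropositionalEquality
open import Relation.Nullary using (¬_; yes; no; contradiction)
open import Relation.Nullary.Decidable using (dec-true; dec-false)

module _ {a} {A : Set a} where

  ∈-─ : ∀ {x y} {xs : List A} (x∈xs : x ∈ xs) → y ∈ xs → x ≢ y → y ∈ xs ─ x∈xs
  ∈-─ (here refl)  (here refl)  x≢y = contradiction refl x≢y
  ∈-─ (here _)     (there y∈xs) _   = y∈xs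
  ∈-─ (there _)    (here refl)  _   = here refl
  ∈-─ (there x∈xs) (there y∈xs) x≢y = there (∈-─ x∈xs y∈xs x≢y)

  Unique⇒length≤ : ∀ {xs ys : List A} → Unique xs → All (_∈ ys) xs → length xs ℕ.≤ length ys
  Unique⇒length≤ []           []              = ℕ.z≤n
  Unique⇒length≤ {ys = ys} (x∉xs ∷ xs!) (x∈ys ∷ xs⊆ys) = ℕ.≤-trans
    (ℕ.s≤s (Unique⇒length≤ xs! xs⊆ys─x))
    (ℕ.≤-reflexive (sym (length-removeAt′ ys _)))
    where
    xs⊆ys─x = All.zipWith (λ (x≢y , y∈ys) → ∈-─ x∈ys y∈ys x≢y) (x∉xs , xs⊆ys)

  length-deduplicate-≤ : (_≟_ : DecidableEquality A) {xs ys : List A} →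
    All (_∈ ys) xs → length (deduplicate _≟_ xs) ℕ.≤ length ys
  length-deduplicate-≤ _≟_ {xs} xs⊆ys =
    Unique⇒length≤ (deduplicate-! _≟_ xs) (deduplicate⁺ _≟_ xs⊆ys)

module _ {a b c} {A : Set a} {B : Set b} {C : Set c} (f : A → B → C) where

  length-cartesianProductWith : ∀ xs ys →
    length (cartesianProductWith f xs ys) ≡ length xs ℕ.* length ys
  length-cartesianProductWith []       ys = refl
  length-cartesianProductWith (x ∷ xs) ys = begin
    length (map (f x) ys ++ cartesianProductWith f xs ys)             ≡⟨ length-++ (map (f x) ys) ⟩
    length (map (f x) ys) ℕ.+ length (cartesianProductWith f xs ys)
      ≡⟨ cong₂ ℕ._+_ (length-map (f x) ys) (length-cartesianProductWith xs ys) ⟩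
    length ys ℕ.+ length xs ℕ.* length ys                             ∎
    where open ≡-Reasoning

module _ where

  open import Data.Fin using (zero; suc)
  open import Data.Integer as ℤ using (ℤ; +_; -[1+_])
  open import Data.Nat.Coprimality using (1-coprimeTo) renaming (sym to coprime-sym)
  open import Data.Rational using (ℚ; 0ℚ; 1ℚ; _+_; _*_; -_; _-_; _/_; mkℚ)
  open import Data.Rational.Properties
    using (+-*-ring; +-*-commutativeRing; +-0-commutativeMonoid; +-identityˡ; +-identityʳ; +-assoc;
           +-inverseʳ; neg-distrib-+; *-identityʳ; *-zeroˡ; *-distribʳ-+; normalize-coprime)
  open import Algebra.Properties.Ring +-*-ring using ([y-z]x≈yx-zx)
  open import Algebra.Properties.Semiring.Sum (CommutativeRing.semiring +-*-commutativeRing)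
    using (sum; sum-syntax; ∑-comm; ∑-distrib-+; *-distribˡ-sum; sum-remove; sum-cong-≗; sum-replicate-zero)
  open CommutativeSemigroupProperties (CommutativeMonoid.commutativeSemigroup +-0-commutativeMonoid)
    using (interchange)

  module _ {a} {A : Set a} where

    sumℚ-++ : ∀ (xs ys : List ℚ) → sumℚ (xs ++ ys) ≡ sumℚ xs + sumℚ ys
    sumℚ-++ []       ys = sym (+-identityˡ (sumℚ ys))
    sumℚ-++ (x ∷ xs) ys =
      trans (cong (_+_ x) (sumℚ-++ xs ys)) (sym (+-assoc x (sumℚ xs) (sumℚ ys)))

    sumℚ-map-+ : ∀ (f g : A → ℚ) xs →
      sumℚ (map (λ x → f x + g x) xs) ≡ sumℚ (map f xs) + sumℚ (map g xs)
    sumℚ-map-+ f g []       = sym (+-identityʳ 0ℚ)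
    sumℚ-map-+ f g (x ∷ xs) =
      trans (cong (_+_ (f x + g x)) (sumℚ-map-+ f g xs)) (interchange (f x) (g x) _ _)

    sumℚ-map-concatMap : ∀ {b} {B : Set b} (f : B → ℚ) (g : A → List B) xs →
      sumℚ (map f (concatMap g xs)) ≡ sumℚ (map (λ x → sumℚ (map f (g x))) xs)
    sumℚ-map-concatMap f g []       = refl
    sumℚ-map-concatMap f g (x ∷ xs) = begin
      sumℚ (map f (g x ++ concatMap g xs))
        ≡⟨ cong sumℚ (map-++ f (g x) _) ⟩
      sumℚ (map f (g x) ++ map f (concatMap g xs))
        ≡⟨ sumℚ-++ (map f (g x)) _ ⟩
      sumℚ (map f (g x)) + sumℚ (map f (concatMap g xs))
        ≡⟨ cong (_+_ (sumℚ (map f (g x)))) (sumℚ-map-concatMap f g xs) ⟩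
      sumℚ (map f (g x)) + sumℚ (map (λ x → sumℚ (map f (g x))) xs) ∎
      where open ≡-Reasoning

    ∑-sumℚ-comm : ∀ {n} (f : A → Fin n → ℚ) xs →
      ∑[ j < n ] sumℚ (map (λ x → f x j) xs) ≡ sumℚ (map (λ x → ∑[ j < n ] f x j) xs)
    ∑-sumℚ-comm {n} f []       = sum-replicate-zero n
    ∑-sumℚ-comm     f (x ∷ xs) =
      trans (∑-distrib-+ (f x) _) (cong (_+_ (sum (f x))) (∑-sumℚ-comm f xs))

    ∑-convex≡1 : ∀ {n} (xs : List A) (c : A → ℚ) (z : A → Fin n → ℚ) →
      sumℚ (map c xs) ≡ 1ℚ → All (λ x → ∑[ j < n ] z x j ≡ 1ℚ) xs →
      ∑[ j < n ] sumℚ (map (λ x → c x * z x j) xs) ≡ 1ℚ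
    ∑-convex≡1 {n} xs c z ∑c≡1 ∑z≡1 = begin
      ∑[ j < n ] sumℚ (map (λ x → c x * z x j) xs)
        ≡⟨ ∑-sumℚ-comm (λ x j → c x * z x j) xs ⟩
      sumℚ (map (λ x → ∑[ j < n ] (c x * z x j)) xs)
        ≡⟨ cong sumℚ (map-cong-local (All.map pull-out ∑z≡1)) ⟩
      sumℚ (map c xs)
        ≡⟨ ∑c≡1 ⟩
      1ℚ ∎
      where
      open ≡-Reasoning
      pull-out : ∀ {x} → ∑[ j < n ] z x j ≡ 1ℚ → ∑[ j < n ] (c x * z x j) ≡ c x
      pull-out {x} ∑zₓ≡1 =
        trans (sym (*-distribˡ-sum (c x) (z x))) (trans (cong (c x *_) ∑zₓ≡1) (*-identityʳ (c x)))

  sumℚ-tabulate : ∀ {n} (f : Fin n → ℚ) → sumℚ (tabulate f) ≡ ∑[ i < n ] f i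
  sumℚ-tabulate {ℕ.zero}  f = refl
  sumℚ-tabulate {ℕ.suc n} f = cong (_+_ (f zero)) (sumℚ-tabulate (f ∘ suc))

  sumℚ-allFin : ∀ {n} (f : Fin n → ℚ) → sumℚ (map f (allFin n)) ≡ ∑[ i < n ] f i
  sumℚ-allFin f = trans (cong sumℚ (map-tabulate (λ i → i) f)) (sumℚ-tabulate f)

  sumE≡∑∑ : ∀ n (f : Fin n × Fin n → ℚ) → sumE n f ≡ ∑[ u < n ] ∑[ w < n ] f (u , w)
  sumE≡∑∑ n f = begin
    sumE n f                                   ≡⟨ sumℚ-map-concatMap f _ (allFin n) ⟩
    sumℚ (map (λ u → sumℚ (row u)) (allFin n))  ≡⟨ sumℚ-allFin (λ u → sumℚ (row u)) ⟩
    ∑[ u < n ] sumℚ (row u)                    ≡⟨ sum-cong-≗ sum-row ⟩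
    ∑[ u < n ] ∑[ w < n ] f (u , w)            ∎
    where
    open ≡-Reasoning
    row : Fin n → List ℚ
    row u = map f (map (u ,_) (allFin n))
    sum-row : ∀ u → sumℚ (row u) ≡ ∑[ w < n ] f (u , w)
    sum-row u = trans (cong sumℚ (sym (map-∘ (allFin n)))) (sumℚ-allFin (λ w → f (u , w)))

  ∑-neg : ∀ {n} (f : Fin n → ℚ) → ∑[ i < n ] (- f i) ≡ - ∑[ i < n ] f i
  ∑-neg {ℕ.zero}  f = refl
  ∑-neg {ℕ.suc n} f =
    trans (cong (_+_ (- f zero)) (∑-neg (f ∘ suc))) (sym (neg-distrib-+ (f zero) _))

  ∑-distrib-minus : ∀ {n} (f g : Fin n → ℚ) →
    ∑[ i < n ] (f i - g i) ≡ ∑[ i < n ] f i - ∑[ i < n ] g i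
  ∑-distrib-minus f g = trans (∑-distrib-+ f (λ i → - g i)) (cong (_+_ (sum f)) (∑-neg g))

  ∑-point : ∀ {n} (f : Fin n → ℚ) i → (∀ j → j ≢ i → f j ≡ 0ℚ) → ∑[ j < n ] f j ≡ f i
  ∑-point {ℕ.suc n} f i off-i = begin
    sum f                             ≡⟨ sum-remove {i = i} f ⟩
    f i + ∑[ j < n ] f (punchIn i j)  ≡⟨ cong (_+_ (f i)) (sum-cong-≗ (λ j → off-i _ (punchInᵢ≢i i j))) ⟩
    f i + ∑[ j < n ] 0ℚ               ≡⟨ cong (_+_ (f i)) (sum-replicate-zero n) ⟩
    f i + 0ℚ                          ≡⟨ +-identityʳ (f i) ⟩
    f i                               ∎
    where open ≡-Reasoning

  ∑-indicator : ∀ {n} (b : Fin n → Bool) i → b i ≡ true → (∀ j → b j ≡ true → j ≡ i) →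
    ∑[ j < n ] (if b j then 1ℚ else 0ℚ) ≡ 1ℚ
  ∑-indicator b i bᵢ only-i = trans (∑-point _ i off-i) (cong (if_then 1ℚ else 0ℚ) bᵢ)
    where
    off-i : ∀ j → j ≢ i → (if b j then 1ℚ else 0ℚ) ≡ 0ℚ
    off-i j j≢i = cong (if_then 1ℚ else 0ℚ) (¬-not (j≢i ∘ only-i j))

  module _ {n} {M : EVec n Bool} (M-perfect : IsPerfectMatching M) where

    ∑-χ-row : ∀ u → ∑[ w < n ] χ M u w ≡ 1ℚ
    ∑-χ-row u = let (w , Muw , only-w) = proj₁ M-perfect u in ∑-indicator (M u) w Muw only-w

    ∑-χ-column : ∀ w → ∑[ u < n ] χ M u w ≡ 1ℚ
    ∑-χ-column w =
      let (u , Muw , only-u) = proj₂ M-perfect w in ∑-indicator (λ u → M u w) u Muw only-u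

  InP⇒∑-row : ∀ {n} {y : EVec n ℚ} → InP y → ∀ u → ∑[ w < n ] y u w ≡ 1ℚ
  InP⇒∑-row (L , valid , total , y≡) u = trans (sum-cong-≗ (y≡ u))
    (∑-convex≡1 L proj₁ (λ p → χ (proj₂ p) u) total
      (All.map (λ (_ , M-perfect , _) → ∑-χ-row M-perfect u) valid))

  InP⇒∑-column : ∀ {n} {y : EVec n ℚ} → InP y → ∀ w → ∑[ u < n ] y u w ≡ 1ℚ
  InP⇒∑-column (L , valid , total , y≡) w = trans (sum-cong-≗ (λ u → y≡ u w))
    (∑-convex≡1 L proj₁ (λ p u → χ (proj₂ p) u w) total
      (All.map (λ (_ , M-perfect , _) → ∑-χ-column M-perfect w) valid))

  ∑∑-potential≡0 : ∀ {n} (g : Fin n → ℚ) (y : EVec n ℚ) →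
    (∀ u → ∑[ w < n ] y u w ≡ 1ℚ) → (∀ w → ∑[ u < n ] y u w ≡ 1ℚ) →
    ∑[ u < n ] ∑[ w < n ] ((g w - g u) * y u w) ≡ 0ℚ
  ∑∑-potential≡0 {n} g y rows columns = begin
    ∑[ u < n ] ∑[ w < n ] ((g w - g u) * y u w)
      ≡⟨ sum-cong-≗ (λ u → trans (sum-cong-≗ (λ w → [y-z]x≈yx-zx (y u w) (g w) (g u)))
                                 (∑-distrib-minus (λ w → g w * y u w) (λ w → g u * y u w))) ⟩
    ∑[ u < n ] (∑[ w < n ] (g w * y u w) - ∑[ w < n ] (g u * y u w))
      ≡⟨ ∑-distrib-minus (λ u → ∑[ w < n ] (g w * y u w)) (λ u → ∑[ w < n ] (g u * y u w)) ⟩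
    ∑[ u < n ] ∑[ w < n ] (g w * y u w) - ∑[ u < n ] ∑[ w < n ] (g u * y u w)
      ≡⟨ cong₂ _-_ (trans (∑-comm (λ u w → g w * y u w)) (weigh columns)) (weigh rows) ⟩
    sum g - sum g
      ≡⟨ +-inverseʳ (sum g) ⟩
    0ℚ ∎
    where
    open ≡-Reasoning
    weigh : {h : Fin n → Fin n → ℚ} → (∀ i → ∑[ j < n ] h i j ≡ 1ℚ) →
      ∑[ i < n ] ∑[ j < n ] (g i * h i j) ≡ sum g
    weigh {h} ∑h≡1 = sum-cong-≗ λ i →
      trans (sym (*-distribˡ-sum (g i) (h i))) (trans (cong (g i *_) (∑h≡1 i)) (*-identityʳ (g i)))

  /1≡mkℚ : ∀ p → p / 1 ≡ mkℚ p 0 (coprime-sym (1-coprimeTo _))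
  /1≡mkℚ (+ n)    = normalize-coprime (coprime-sym (1-coprimeTo n))
  /1≡mkℚ -[1+ n ] = cong -_ (normalize-coprime (coprime-sym (1-coprimeTo (ℕ.suc n))))

  /1-+ : ∀ p q → (p ℤ.+ q) / 1 ≡ p / 1 + q / 1
  /1-+ p q rewrite /1≡mkℚ p | /1≡mkℚ q =
    cong₂ (λ a b → (a ℤ.+ b) / 1) (sym (ℤ.*-identityʳ p)) (sym (ℤ.*-identityʳ q))

  /1-neg : ∀ p → (ℤ.- p) / 1 ≡ - (p / 1)
  /1-neg p rewrite /1≡mkℚ p | /1≡mkℚ (ℤ.- p) with p
  ... | + ℕ.zero  = refl
  ... | + ℕ.suc n = refl
  ... | -[1+ n ]  = refl

  /1-minus : ∀ p q → (p ℤ.- q) / 1 ≡ p / 1 - q / 1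
  /1-minus p q = trans (/1-+ p (ℤ.- q)) (cong (_+_ (p / 1)) (/1-neg q))

  dotℤ-potential-shift : ∀ {n} (a : EVec n ℕ) → (∀ u → a u u ≡ 0) → (ν : Fin n → ℤ) →
    (y : EVec n ℚ) → InP y →
    dotℤ (λ u w → + a u w ℤ.+ (ν w ℤ.- ν u)) y
      ≡ sumE n (λ e → if isRed e then (+ a (proj₁ e) (proj₂ e) / 1) * y (proj₁ e) (proj₂ e) else 0ℚ)
  dotℤ-potential-shift {n} a a-diagonal ν y y∈P = begin
    sumℚ (map (λ (u , w) → ((+ a u w ℤ.+ (ν w ℤ.- ν u)) / 1) * y u w) E)
      ≡⟨ cong sumℚ (map-cong split E) ⟩
    sumℚ (map (λ e → red e + potential e) E)
      ≡⟨ sumℚ-map-+ red potential E ⟩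
    sumℚ (map red E) + sumE n potential
      ≡⟨ cong (_+_ (sumℚ (map red E))) potential≡0 ⟩
    sumℚ (map red E) + 0ℚ
      ≡⟨ +-identityʳ _ ⟩
    sumℚ (map red E) ∎
    where
    open ≡-Reasoning
    E = allEdges n
    g : Fin n → ℚ
    g u = ν u / 1
    red potential : Fin n × Fin n → ℚ
    red (u , w) = if isRed (u , w) then (+ a u w / 1) * y u w else 0ℚ
    potential (u , w) = (g w - g u) * y u w
    red≡ : ∀ u w → red (u , w) ≡ (+ a u w / 1) * y u w
    red≡ u w with u Data.Fin.≟ w
    ... | yes refl rewrite a-diagonal u = sym (*-zeroˡ (y u u))
    ... | no _     = refl
    split : ∀ ((u , w) : Fin n × Fin n) →
      ((+ a u w ℤ.+ (ν w ℤ.- ν u)) / 1) * y u w ≡ red (u , w) + potential (u , w)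
    split (u , w) = begin
      ((+ a u w ℤ.+ (ν w ℤ.- ν u)) / 1) * y u w
        ≡⟨ cong (_* y u w) (trans (/1-+ (+ a u w) (ν w ℤ.- ν u))
                                  (cong (_+_ (+ a u w / 1)) (/1-minus (ν w) (ν u)))) ⟩
      (+ a u w / 1 + (g w - g u)) * y u w
        ≡⟨ *-distribʳ-+ (y u w) (+ a u w / 1) (g w - g u) ⟩
      (+ a u w / 1) * y u w + potential (u , w)
        ≡⟨ cong (_+ potential (u , w)) (sym (red≡ u w)) ⟩
      red (u , w) + potential (u , w) ∎
    potential≡0 : sumE n potential ≡ 0ℚ
    potential≡0 =
      trans (sumE≡∑∑ n potential) (∑∑-potential≡0 g y (InP⇒∑-row y∈P) (InP⇒∑-column y∈P))

  same-face : ∀ {n} {f g : EVec n ℚ → ℚ} {b} → (∀ y → InP y → f y ≡ g y) →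
    ∀ y → (InP y × f y ≡ b) ⇔ (InP y × g y ≡ b)
  same-face f≡g y = mk⇔ (λ (y∈P , fy≡b) → y∈P , trans (sym (f≡g y y∈P)) fy≡b)
                        (λ (y∈P , gy≡b) → y∈P , trans (f≡g y y∈P) gy≡b)

≡ᵇ-true : ∀ {x y} → x ≡ y → (x ℕ.≡ᵇ y) ≡ true
≡ᵇ-true {x} {y} = dec-true (x ℕ.≟ y)

≡ᵇ-false : ∀ {x y} → x ≢ y → (x ℕ.≡ᵇ y) ≡ false
≡ᵇ-false {x} {y} = dec-false (x ℕ.≟ y)

<ᵇ-true : ∀ {x y} → x ℕ.< y → (x ℕ.<ᵇ y) ≡ true
<ᵇ-true {x} {y} = dec-true (x ℕ.<? y)

<ᵇ-false : ∀ {x y} → ¬ x ℕ.< y → (x ℕ.<ᵇ y) ≡ false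
<ᵇ-false {x} {y} = dec-false (x ℕ.<? y)

dist-≤ : ∀ {x y} → x ℕ.≤ y → dist x y ≡ y ℕ.∸ x
dist-≤ {x} {y} x≤y = cong (ℕ._+ (y ℕ.∸ x)) (ℕ.m≤n⇒m∸n≡0 x≤y)

dist-≥ : ∀ {x y} → y ℕ.≤ x → dist x y ≡ x ℕ.∸ y
dist-≥ {x} {y} y≤x = trans (cong ((x ℕ.∸ y) ℕ.+_) (ℕ.m≤n⇒m∸n≡0 y≤x)) (ℕ.+-identityʳ (x ℕ.∸ y))

module _ where

  open import Data.Integer using (+_; _-_)
  open import Data.Integer.Properties using (m-n≡m⊖n; ⊖-≥)

  pos-∸ : ∀ {m n} → n ℕ.≤ m → + (m ℕ.∸ n) ≡ + m - + n
  pos-∸ {m} {n} n≤m = sym (trans (m-n≡m⊖n m n) (⊖-≥ n≤m))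

module Digits (s : ℕ) .{{_ : ℕ.NonZero s}} where

  open import Data.Integer using (ℤ; +_; _+_; _-_; _*_; -_)
  open import Data.Integer.Properties using (pos-+; pos-*; m-n≡m⊖n; ⊖-<)

  low mid high : ℕ → ℕ
  low x = x ℕ.% s
  mid x = x ℕ./ s ℕ.% s
  high x = x ℕ./ s ℕ./ s

  digits : ∀ x → x ≡ low x ℕ.+ (mid x ℕ.+ high x ℕ.* s) ℕ.* s
  digits x = trans (m≡m%n+[m/n]*n x s) (cong (λ q → low x ℕ.+ q ℕ.* s) (m≡m%n+[m/n]*n (x ℕ./ s) s))

  pos-digits : ∀ x → + x ≡ + low x + (+ mid x + + high x * + s) * + s
  pos-digits x = begin
    + x                                      ≡⟨ cong +_ (digits x) ⟩
    + (low x ℕ.+ upper ℕ.* s)                ≡⟨ pos-+ (low x) _ ⟩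
    + low x + + (upper ℕ.* s)                ≡⟨ cong (λ q → + low x + q) (pos-* upper s) ⟩
    + low x + + upper * + s                  ≡⟨ cong (λ q → + low x + q * + s) (pos-+ (mid x) (high x ℕ.* s)) ⟩
    + low x + (+ mid x + + (high x ℕ.* s)) * + s
      ≡⟨ cong (λ q → + low x + (+ mid x + q) * + s) (pos-* (high x) s) ⟩
    + low x + (+ mid x + + high x * + s) * + s ∎
    where
    open ≡-Reasoning
    upper = mid x ℕ.+ high x ℕ.* s

  low<s : ∀ x → low x ℕ.< s
  low<s x = m%n<n x s

  mid<s : ∀ x → mid x ℕ.< s
  mid<s x = m%n<n (x ℕ./ s) s

  high<s : ∀ {x} → x ℕ.< s ℕ.^ 3 → high x ℕ.< s
  high<s {x} x<s³ = m<n*o⇒m/o<n (m<n*o⇒m/o<n (subst (x ℕ.<_) s³≡ x<s³))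
    where
    s³≡ : s ℕ.^ 3 ≡ s ℕ.* s ℕ.* s
    s³≡ = trans (cong (λ q → s ℕ.* (s ℕ.* q)) (ℕ.*-identityʳ s)) (sym (ℕ.*-assoc s s s))

  window : List ℤ
  window = map +_ (upTo s) ++ map (λ i → - + i) (upTo s)

  diff∈window : ∀ {a b} → a ℕ.< s → b ℕ.< s → + a - + b ∈ window
  diff∈window {a} {b} a<s b<s with b ℕ.≤? a
  ... | yes b≤a = subst (_∈ window) (pos-∸ b≤a)
    (∈-++⁺ˡ (∈-map⁺ +_ (∈-upTo⁺ (ℕ.≤-<-trans (ℕ.m∸n≤m a b) a<s))))
  ... | no b≰a = subst (_∈ window) (sym (trans (m-n≡m⊖n a b) (⊖-< (ℕ.≰⇒> b≰a))))
    (∈-++⁺ʳ (map +_ (upTo s)) (∈-map⁺ (λ i → - + i) (∈-upTo⁺ (ℕ.≤-<-trans (ℕ.m∸n≤m b a) b<s))))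

  length-window : length window ≡ s ℕ.+ s
  length-window = trans (length-++ (map +_ (upTo s)))
    (cong₂ ℕ._+_ (trans (length-map +_ (upTo s)) (length-upTo s))
                 (trans (length-map (λ i → - + i) (upTo s)) (length-upTo s)))

module CanonicalCoefficients (k : ℕ) where

  open import Data.Integer using (ℤ; +_; 0ℤ; _+_; _-_; -_)
  open import Data.Integer.Properties using (+-identityˡ)
  open import Data.Integer.Tactic.RingSolver using (solve-∀)

  m : ℕ
  m = ℕ.suc (2 ℕ.* k)

  M : ℤ
  M = + m

  ℓ : ℕ → ℕ → ℕ
  ℓ x y = if isOddℕ (dist x y) then dist x y else m ℕ.∸ dist x y

  δ : ℕ → ℕ → ℤ
  δ x y = + y - + x

  offsets : List ℤ
  offsets = 0ℤ ∷ M ∷ []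

  private
    negate-ring : ∀ a b → - (b - a) ≡ a - b
    negate-ring = solve-∀

  short-way : ∀ {a b} → b ℕ.≤ a → + (a ℕ.∸ b) ≡ 0ℤ + δ b a
  short-way b≤a = trans (pos-∸ b≤a) (sym (+-identityˡ _))

  long-way : ∀ {a b} → b ℕ.≤ a → a ℕ.< m → + (m ℕ.∸ (a ℕ.∸ b)) ≡ M + δ a b
  long-way {a} {b} b≤a a<m = begin
    + (m ℕ.∸ (a ℕ.∸ b))  ≡⟨ pos-∸ (ℕ.≤-trans (ℕ.m∸n≤m a b) (ℕ.<⇒≤ a<m)) ⟩
    M - + (a ℕ.∸ b)      ≡⟨ cong (λ d → M - d) (pos-∸ b≤a) ⟩
    M - δ b a            ≡⟨ cong (_+_ M) (negate-ring (+ b) (+ a)) ⟩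
    M + δ a b            ∎
    where open ≡-Reasoning

  ℓ-shape : ∀ {x y} → x ℕ.< m → y ℕ.< m →
    Σ ℤ λ c → c ∈ offsets × (+ ℓ x y ≡ c + δ x y ⊎ + ℓ x y ≡ c + δ y x)
  ℓ-shape {x} {y} x<m y<m with isOddℕ (dist x y) | ℕ.≤-total x y
  ... | true  | inj₁ x≤y = 0ℤ , here refl , inj₁ (trans (cong +_ (dist-≤ x≤y)) (short-way x≤y))
  ... | true  | inj₂ y≤x = 0ℤ , here refl , inj₂ (trans (cong +_ (dist-≥ y≤x)) (short-way y≤x))
  ... | false | inj₁ x≤y = M , there (here refl) ,
                           inj₂ (trans (cong (λ d → + (m ℕ.∸ d)) (dist-≤ x≤y)) (long-way x≤y y<m))
  ... | false | inj₂ y≤x = M , there (here refl) ,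
                           inj₁ (trans (cong (λ d → + (m ℕ.∸ d)) (dist-≥ y≤x)) (long-way y≤x x<m))

  module _ {i j : Fin (3 ℕ.+ 2 ℕ.* k)} where

    aCanon-same : toℕ i ≡ toℕ j → aCanon k i j ≡ 0
    aCanon-same x≡y rewrite ≡ᵇ-true x≡y = refl

    aCanon-cycle : toℕ i ≢ toℕ j → toℕ i ℕ.< m → toℕ j ℕ.< m → aCanon k i j ≡ ℓ (toℕ i) (toℕ j)
    aCanon-cycle x≢y x<m y<m rewrite ≡ᵇ-false x≢y | <ᵇ-true x<m | <ᵇ-true y<m = refl

    aCanon-leave : toℕ i ≢ toℕ j → toℕ i ℕ.< m → ¬ toℕ j ℕ.< m → aCanon k i j ≡ k
    aCanon-leave x≢y x<m y≮m rewrite ≡ᵇ-false x≢y | <ᵇ-true x<m | <ᵇ-false y≮m = refl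

    aCanon-enter : toℕ i ≢ toℕ j → ¬ toℕ i ℕ.< m → toℕ j ℕ.< m → aCanon k i j ≡ k
    aCanon-enter x≢y x≮m y<m rewrite ≡ᵇ-false x≢y | <ᵇ-false x≮m | <ᵇ-true y<m = refl

    aCanon-outer : toℕ i ≢ toℕ j → ¬ toℕ i ℕ.< m → ¬ toℕ j ℕ.< m → aCanon k i j ≡ 1
    aCanon-outer x≢y x≮m y≮m rewrite ≡ᵇ-false x≢y | <ᵇ-false x≮m | <ᵇ-false y≮m = refl

module Compression (k t : ℕ) (m≤s³ : ℕ.suc (2 ℕ.* k) ℕ.≤ ℕ.suc t ℕ.^ 3) where

  open import Data.Integer using (ℤ; +_; 0ℤ; 1ℤ; _+_; _-_; _*_; -_)
  open import Data.Integer.Properties using (_≟_; +-assoc; +-inverseʳ)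
  open import Data.Integer.Tactic.RingSolver using (solve-∀)
  open import Data.Nat.Solver using (module +-*-Solver)
  open +-*-Solver using (solve; _:+_; _:*_; _:^_; _:=_; con)

  s : ℕ
  s = ℕ.suc t

  open CanonicalCoefficients k
  open Digits s

  S K : ℤ
  S = + s
  K = + k

  φ : ℕ → ℤ
  φ x = + high x * S * S - + low x

  ν : ℕ → ℤ
  ν x = if x ℕ.<ᵇ m then φ x else 0ℤ

  ν-cycle : ∀ {x} → x ℕ.< m → ν x ≡ φ x
  ν-cycle {x} x<m = cong (if_then φ x else 0ℤ) (<ᵇ-true x<m)

  ν-outer : ∀ {x} → ¬ x ℕ.< m → ν x ≡ 0ℤ
  ν-outer {x} x≮m = cong (if_then φ x else 0ℤ) (<ᵇ-false x≮m)

  cycle-high<s : ∀ {x} → x ℕ.< m → high x ℕ.< s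
  cycle-high<s x<m = high<s (ℕ.<-≤-trans x<m m≤s³)

  Δ : (ℕ → ℕ) → ℕ → ℕ → ℤ
  Δ digit x y = + digit y - + digit x

  rise fall enter leave : ℤ → ℤ → ℤ
  rise p q = + 2 * S * S * p + S * q
  fall p q = - (S * p) - + 2 * q
  enter p q = K + (S * S * p - q)
  leave p q = K + (q - S * S * p)

  private
    rise-ring : ∀ A a b A′ a′ b′ S →
      ((b′ + (a′ + A′ * S) * S) - (b + (a + A * S) * S)) + ((A′ * S * S - b′) - (A * S * S - b))
        ≡ + 2 * S * S * (A′ - A) + S * (a′ - a)
    rise-ring = solve-∀

    fall-ring : ∀ A a b A′ a′ b′ S →
      ((b + (a + A * S) * S) - (b′ + (a′ + A′ * S) * S)) + ((A′ * S * S - b′) - (A * S * S - b))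
        ≡ - (S * (a′ - a)) - + 2 * (b′ - b)
    fall-ring = solve-∀

    leave-ring : ∀ K A b S → K + (0ℤ - (A * S * S - b)) ≡ K + ((b - 0ℤ) - S * S * (A - 0ℤ))
    leave-ring = solve-∀

    enter-ring : ∀ K A b S → K + ((A * S * S - b) - 0ℤ) ≡ K + (S * S * (A - 0ℤ) - (b - 0ℤ))
    enter-ring = solve-∀

  δ+Δφ≡rise : ∀ x y → δ x y + (φ y - φ x) ≡ rise (Δ high x y) (Δ mid x y)
  δ+Δφ≡rise x y = trans (cong (_+ (φ y - φ x)) (cong₂ _-_ (pos-digits y) (pos-digits x)))
    (rise-ring (+ high x) (+ mid x) (+ low x) (+ high y) (+ mid y) (+ low y) S)

  δ′+Δφ≡fall : ∀ x y → δ y x + (φ y - φ x) ≡ fall (Δ mid x y) (Δ low x y)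
  δ′+Δφ≡fall x y = trans (cong (_+ (φ y - φ x)) (cong₂ _-_ (pos-digits x) (pos-digits y)))
    (fall-ring (+ high x) (+ mid x) (+ low x) (+ high y) (+ mid y) (+ low y) S)

  shifted : ℤ → (ℤ → ℤ → ℤ) → ℤ → ℤ → ℤ
  shifted c f p q = c + f p q

  cycleForms otherForms forms : List (ℤ → ℤ → ℤ)
  cycleForms = cartesianProductWith shifted offsets (rise ∷ fall ∷ [])
  otherForms = enter ∷ leave ∷ (λ _ _ → 0ℤ) ∷ (λ _ _ → 1ℤ) ∷ []
  forms = cycleForms ++ otherForms

  cycleForm∈forms : ∀ {c f} → c ∈ offsets → f ∈ rise ∷ fall ∷ [] → shifted c f ∈ forms
  cycleForm∈forms c∈offsets f∈ = ∈-++⁺ˡ (∈-cartesianProductWith⁺ shifted c∈offsets f∈)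

  otherForm∈forms : ∀ {f} → f ∈ otherForms → f ∈ forms
  otherForm∈forms = ∈-++⁺ʳ cycleForms

  evaluate : (ℤ → ℤ → ℤ) → ℤ × ℤ → ℤ
  evaluate f (p , q) = f p q

  values : List ℤ
  values = cartesianProductWith evaluate forms (cartesianProduct window window)

  value∈values : ∀ {f v a b c d} → f ∈ forms → a ℕ.< s → b ℕ.< s → c ℕ.< s → d ℕ.< s →
    v ≡ f (+ a - + b) (+ c - + d) → v ∈ values
  value∈values f∈ a<s b<s c<s d<s refl =
    ∈-cartesianProductWith⁺ evaluate f∈
      (∈-cartesianProduct⁺ (diff∈window a<s b<s) (diff∈window c<s d<s))

  length-values : length values ≡ 32 ℕ.* s ℕ.^ 2
  length-values = begin
    length values
      ≡⟨ length-cartesianProductWith evaluate forms (cartesianProduct window window) ⟩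
    8 ℕ.* length (cartesianProduct window window)
      ≡⟨ cong (8 ℕ.*_) (length-cartesianProductWith _,_ window window) ⟩
    8 ℕ.* (length window ℕ.* length window)
      ≡⟨ cong (λ l → 8 ℕ.* (l ℕ.* l)) length-window ⟩
    8 ℕ.* ((s ℕ.+ s) ℕ.* (s ℕ.+ s))
      ≡⟨ square s ⟩
    32 ℕ.* s ℕ.^ 2 ∎
    where
    open ≡-Reasoning
    square : ∀ s → 8 ℕ.* ((s ℕ.+ s) ℕ.* (s ℕ.+ s)) ≡ 32 ℕ.* s ℕ.^ 2
    square = solve 1 (λ s → con 8 :* ((s :+ s) :* (s :+ s)) := con 32 :* s :^ 2) refl

  cycle∈values : ∀ {x y} → x ℕ.< m → y ℕ.< m → + ℓ x y + (φ y - φ x) ∈ values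
  cycle∈values {x} {y} x<m y<m with ℓ-shape x<m y<m
  ... | c , c∈offsets , inj₁ ℓ≡c+δ =
    value∈values (cycleForm∈forms c∈offsets (here refl))
      (cycle-high<s y<m) (cycle-high<s x<m) (mid<s y) (mid<s x) (begin
        + ℓ x y + (φ y - φ x)      ≡⟨ cong (_+ (φ y - φ x)) ℓ≡c+δ ⟩
        c + δ x y + (φ y - φ x)    ≡⟨ +-assoc c (δ x y) _ ⟩
        c + (δ x y + (φ y - φ x))  ≡⟨ cong (_+_ c) (δ+Δφ≡rise x y) ⟩
        shifted c rise (Δ high x y) (Δ mid x y) ∎)
    where open ≡-Reasoning
  ... | c , c∈offsets , inj₂ ℓ≡c+δ′ =
    value∈values (cycleForm∈forms c∈offsets (there (here refl)))
      (mid<s y) (mid<s x) (low<s y) (low<s x) (begin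
        + ℓ x y + (φ y - φ x)      ≡⟨ cong (_+ (φ y - φ x)) ℓ≡c+δ′ ⟩
        c + δ y x + (φ y - φ x)    ≡⟨ +-assoc c (δ y x) _ ⟩
        c + (δ y x + (φ y - φ x))  ≡⟨ cong (_+_ c) (δ′+Δφ≡fall x y) ⟩
        shifted c fall (Δ mid x y) (Δ low x y) ∎)
    where open ≡-Reasoning

  shiftedCoefficient : Fin (3 ℕ.+ 2 ℕ.* k) → Fin (3 ℕ.+ 2 ℕ.* k) → ℤ
  shiftedCoefficient i j = + aCanon k i j + (ν (toℕ j) - ν (toℕ i))

  shiftedCoefficient∈values : ∀ i j → shiftedCoefficient i j ∈ values
  shiftedCoefficient∈values i j with toℕ i ℕ.≟ toℕ j | toℕ i ℕ.<? m | toℕ j ℕ.<? m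
  ... | yes x≡y | _ | _ =
    value∈values (otherForm∈forms (there (there (here refl)))) ℕ.z<s ℕ.z<s ℕ.z<s ℕ.z<s (begin
      + aCanon k i j + (ν (toℕ j) - ν (toℕ i))
        ≡⟨ cong₂ (λ a z → + a + (ν z - ν (toℕ i))) (aCanon-same x≡y) (sym x≡y) ⟩
      + 0 + (ν (toℕ i) - ν (toℕ i))
        ≡⟨ cong (_+_ (+ 0)) (+-inverseʳ (ν (toℕ i))) ⟩
      0ℤ ∎)
    where open ≡-Reasoning
  ... | no x≢y | yes x<m | yes y<m = subst (_∈ values)
    (sym (cong₂ _+_ (cong +_ (aCanon-cycle x≢y x<m y<m)) (cong₂ _-_ (ν-cycle y<m) (ν-cycle x<m))))
    (cycle∈values x<m y<m)
  ... | no x≢y | yes x<m | no y≮m =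
    value∈values (otherForm∈forms (there (here refl))) (cycle-high<s x<m) ℕ.z<s (low<s (toℕ i)) ℕ.z<s (begin
      + aCanon k i j + (ν (toℕ j) - ν (toℕ i))
        ≡⟨ cong₂ (λ a b → + a + b) (aCanon-leave x≢y x<m y≮m) (cong₂ _-_ (ν-outer y≮m) (ν-cycle x<m)) ⟩
      K + (0ℤ - φ (toℕ i))
        ≡⟨ leave-ring K (+ high (toℕ i)) (+ low (toℕ i)) S ⟩
      leave (+ high (toℕ i) - + 0) (+ low (toℕ i) - + 0) ∎)
    where open ≡-Reasoning
  ... | no x≢y | no x≮m | yes y<m =
    value∈values (otherForm∈forms (here refl)) (cycle-high<s y<m) ℕ.z<s (low<s (toℕ j)) ℕ.z<s (begin
      + aCanon k i j + (ν (toℕ j) - ν (toℕ i))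
        ≡⟨ cong₂ (λ a b → + a + b) (aCanon-enter x≢y x≮m y<m) (cong₂ _-_ (ν-cycle y<m) (ν-outer x≮m)) ⟩
      K + (φ (toℕ j) - 0ℤ)
        ≡⟨ enter-ring K (+ high (toℕ j)) (+ low (toℕ j)) S ⟩
      enter (+ high (toℕ j) - + 0) (+ low (toℕ j) - + 0) ∎)
    where open ≡-Reasoning
  ... | no x≢y | no x≮m | no y≮m =
    value∈values (otherForm∈forms (there (there (there (here refl))))) ℕ.z<s ℕ.z<s ℕ.z<s ℕ.z<s
      (cong₂ (λ a b → + a + b) (aCanon-outer x≢y x≮m y≮m) (cong₂ _-_ (ν-outer y≮m) (ν-outer x≮m)))

  relabelled : Permutation′ (3 ℕ.+ 2 ℕ.* k) → EVec (3 ℕ.+ 2 ℕ.* k) ℤ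
  relabelled π u w = shiftedCoefficient (π ⟨$⟩ˡ u) (π ⟨$⟩ˡ w)

  dotℤ-relabelled : ∀ π y → InP y → dotℤ (relabelled π) y ≡ canonLHS k π y
  dotℤ-relabelled π = dotℤ-potential-shift (aC k π)
    (λ u → aCanon-same {π ⟨$⟩ˡ u} {π ⟨$⟩ˡ u} refl) (λ u → ν (toℕ (π ⟨$⟩ˡ u)))

  numDistinct-relabelled : ∀ π → numDistinct (relabelled π) ℕ.≤ 32 ℕ.* s ℕ.^ 2
  numDistinct-relabelled π = ℕ.≤-trans
    (length-deduplicate-≤ _≟_ (map⁺ {f = λ (u , w) → relabelled π u w} (All.universal
      (λ (u , w) → shiftedCoefficient∈values (π ⟨$⟩ˡ u) (π ⟨$⟩ˡ w)) (allEdges (3 ℕ.+ 2 ℕ.* k)))))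
    (ℕ.≤-reflexive length-values)

open import Data.Nat using (ℕ; _<_; _≤_; _+_; _*_; _^_)
open import Data.Integer using (ℤ; +_)
open import Data.Rational using (ℚ; _/_)
open import Data.Fin.Permutation using (Permutation′)
open import Data.Product using (Σ; _×_)
open import Function.Bundles using (_⇔_)
open import Relation.Binary.PropositionalEquality using (_≡_)
open import Data.Nat using (zero; suc; z≤n; s≤s; _≤?_)
open import Data.Nat.Solver using (module +-*-Solver)
open +-*-Solver using (solve; _:+_; _:*_; _:^_; _:=_; con)

double-cube : ∀ a → (a + a) ^ 3 ≡ 8 * a ^ 3
double-cube = solve 1 (λ a → (a :+ a) :^ 3 := con 8 :* a :^ 3) refl

cube-bracket : ∀ m → Σ ℕ λ t → suc m ≤ suc t ^ 3 × suc t ^ 3 ≤ 8 * suc m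
cube-bracket zero = 0 , s≤s z≤n , s≤s z≤n
cube-bracket (suc m) with cube-bracket m
... | t , lower , upper with suc (suc m) ≤? suc t ^ 3
...   | yes lower′ = t , lower′ , ℕ.≤-trans upper (ℕ.*-monoʳ-≤ 8 (ℕ.n≤1+n (suc m)))
...   | no lower-fails = suc t , grow , double
  where
  open ℕ.≤-Reasoning
  t³≡ : suc t ^ 3 ≡ suc m
  t³≡ = ℕ.≤-antisym (ℕ.≤-pred (ℕ.≰⇒> lower-fails)) lower
  grow : suc (suc m) ≤ suc (suc t) ^ 3
  grow = subst (λ z → suc z ≤ suc (suc t) ^ 3) t³≡ (ℕ.^-monoˡ-< 3 (ℕ.n<1+n (suc t)))
  double : suc (suc t) ^ 3 ≤ 8 * suc (suc m)
  double = begin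
    suc (suc t) ^ 3          ≤⟨ ℕ.^-monoˡ-≤ 3 (s≤s (ℕ.m≤n+m (suc t) t)) ⟩
    (suc t + suc t) ^ 3      ≡⟨ double-cube (suc t) ⟩
    8 * suc t ^ 3              ≡⟨ cong (8 *_) t³≡ ⟩
    8 * suc m                  ≤⟨ ℕ.*-monoʳ-≤ 8 (ℕ.n≤1+n (suc m)) ⟩
    8 * suc (suc m)          ∎

cube-of-bound : ∀ {N s n} a b → N ≤ a * s ^ 2 → s ^ 3 ≤ b * n → N ^ 3 ≤ a ^ 3 * b ^ 2 * n ^ 2
cube-of-bound {N} {s} {n} a b N≤ s³≤ = begin
  N ^ 3                  ≤⟨ ℕ.^-monoˡ-≤ 3 N≤ ⟩
  (a * s ^ 2) ^ 3        ≡⟨ regroup a s ⟩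
  a ^ 3 * (s ^ 3) ^ 2    ≤⟨ ℕ.*-monoʳ-≤ (a ^ 3) (ℕ.^-monoˡ-≤ 2 s³≤) ⟩
  a ^ 3 * (b * n) ^ 2    ≡⟨ expand (a ^ 3) b n ⟩
  a ^ 3 * b ^ 2 * n ^ 2  ∎
  where
  open ℕ.≤-Reasoning
  regroup : ∀ a s → (a * s ^ 2) ^ 3 ≡ a ^ 3 * (s ^ 3) ^ 2
  regroup = solve 2 (λ a s → (a :* s :^ 2) :^ 3 := a :^ 3 :* (s :^ 3) :^ 2) refl
  expand : ∀ c b n → c * (b * n) ^ 2 ≡ c * b ^ 2 * n ^ 2
  expand = solve 3 (λ c b n → c :* (b :* n) :^ 2 := c :* b :^ 2 :* n :^ 2) refl

theoremA2 : Σ ℕ λ c → (0 < c) ×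
    ((k : ℕ) → (π : Permutation′ (3 + 2 * k)) →
      Σ (EVec (3 + 2 * k) ℤ) λ â → Σ ℤ λ b̂ →
        ((y : EVec (3 + 2 * k) ℚ) →
          (InP y × (canonLHS k π y ≡ (+ (1 + 2 * k) / 1))) ⇔ (InP y × (dotℤ â y ≡ (b̂ / 1))))
        × (numDistinct â ^ 3 ≤ (c ^ 3) * ((3 + 2 * k) ^ 2)))
theoremA2 = 128 , s≤s z≤n , λ k π →
  let (t , m≤s³ , s³≤8m) = cube-bracket (2 * k)
      open Compression k t m≤s³
      s³≤8n = ℕ.≤-trans s³≤8m (ℕ.*-monoʳ-≤ 8 (ℕ.m≤n+m (suc (2 * k)) 2))
  in relabelled π , + (1 + 2 * k)
   , same-face (λ y y∈P → sym (dotℤ-relabelled π y y∈P))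
   , cube-of-bound {s = suc t} {n = 3 + 2 * k} 32 8 (numDistinct-relabelled π) s³≤8n  -- 32³ · 8² = 128³
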